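{- Let $M_1=(E,r_1)$ and $M_2=(E,r_2)$ be matroids on a common finite ground set $E$, with duals $M_1^*,M_2^*$. Then $$S_{M_2^*,M_1^*}(X,Y,Z)=(Z-1)^{|E|}S_{M_1,M_2}\Big(Y,X,\frac{Z}{Z-1}\Big),$$ and $$S_{M_1^*,M_2^*}(X,Y,Z)=(X-1)^{ -r_1(E)}(Y-1)^{r_2(E)}(Z-1)^{|E|-r_1(E)-r_2(E)}S_{M_1,M_2}\Big(Y,X,1+\frac{(X-1)(Z-1)}{Y-1}\Big).$$
   Context: For matroids $M_1=(E,r_1)$, $M_2=(E,r_2)$ (given by rank functions) on a common ground set, the joint Tutte polynomial of the ordered pair is $$S_{M_1,M_2}(X,Y,Z)=\sum_{A\subseteq E}(X-1)^{r_1(E)-r_1(A)}(Y-1)^{|A|-r_2(A)}(Z-1)^{r_2(A)+r_1(E)-r_1(A)}.$$ The dual of $M=(E,r)$ is $M^*=(E,r^*)$ with $r^*(A)=r(E\setminus A)+|A|-r(E)$. The identities are identities of rational functions. -}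

module Defs where

open import Data.Nat as ℕ using (ℕ; zero; suc; _≤_; _∸_)
open import Data.Integer as ℤ using (ℤ; +_; -[1+_])
open import Data.Bool using (Bool; true; false)
open import Data.Vec using (Vec; []; _∷_)
open import Data.List using (List; []; _∷_; _++_; map; foldr)
open import Data.Fin.Subset using (Subset; ⊤; ∁; _⊆_; _∪_; _∩_; ∣_∣)
open import Data.Rational as ℚ using (ℚ; 0ℚ; 1ℚ; _+_; _*_; _-_; 1/_; ≢-nonZero)
open import Data.Rational.Properties using (_≟_)
open import Relation.Nullary using (yes; no)

record Matroid (n : ℕ) : Set where
  field
    rank        : Subset n → ℕ
    rank-bound  : ∀ A → rank A ≤ ∣ A ∣
    rank-mono   : ∀ A B → A ⊆ B → rank A ≤ rank B
    rank-submod : ∀ A B → rank (A ∪ B) ℕ.+ rank (A ∩ B) ≤ rank A ℕ.+ rank B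
open Matroid public

-- Dual rank function: r*(A) = r(E \ A) + |A| - r(E)
-- (the truncated subtraction never truncates when r is a matroid rank function).
dualRank : ∀ {n} → (Subset n → ℕ) → Subset n → ℕ
dualRank r A = (r (∁ A) ℕ.+ ∣ A ∣) ∸ r ⊤

allSubsets : (n : ℕ) → List (Subset n)
allSubsets zero    = [] ∷ []
allSubsets (suc n) = map (true ∷_) (allSubsets n) ++ map (false ∷_) (allSubsets n)

sumℚ : List ℚ → ℚ
sumℚ = foldr _+_ 0ℚ

_^_ : ℚ → ℕ → ℚ
x ^ zero  = 1ℚ
x ^ suc k = x * (x ^ k)

-- total inverse (inv 0 = 0); only ever applied to nonzero values in the statement
inv : ℚ → ℚ
inv p with p ≟ 0ℚ
... | yes _  = 0ℚ
... | no p≢0 = 1/_ p {{≢-nonZero p≢0}}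

_^ℤ_ : ℚ → ℤ → ℚ
x ^ℤ (+ k)     = x ^ k
x ^ℤ -[1+ k ]  = inv (x ^ suc k)

S : ∀ {n} → (Subset n → ℕ) → (Subset n → ℕ) → ℚ → ℚ → ℚ → ℚ
S {n} r₁ r₂ X Y Z = sumℚ (map term (allSubsets n))
  where
  term : Subset n → ℚ
  term A = ((X - 1ℚ) ^ (r₁ ⊤ ∸ r₁ A))
         * (((Y - 1ℚ) ^ (∣ A ∣ ∸ r₂ A))
         * ((Z - 1ℚ) ^ ((r₂ A ℕ.+ r₁ ⊤) ∸ r₁ A)))

-- Complementation A ↦ E ∖ A matches the summands of a joint Tutte polynomial of
-- dual matroids with those of the original one.  Since
-- r*(A) = r(E ∖ A) + |A| - r(E), the summand of S_{M₁*,M₂*} (or S_{M₂*,M₁*}) at A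
-- is a Laurent monomial in X - 1, Y - 1, Z - 1 whose exponents are affine in n,
-- |A|, r_i(E ∖ A) and r_i(E).  The rank axioms guarantee that none of the
-- truncated subtractions in these exponents truncates, so they can be compared
-- as integers: after the substitutions X ↔ Y and Z ↦ Z/(Z - 1), resp.
-- Z ↦ 1 + (X - 1)(Z - 1)/(Y - 1), they differ from the exponents of the summand
-- of S_{M₁,M₂} at E ∖ A by amounts independent of A, which is the prefactor.
module Submission where

open import Defs
open import Algebra.Bundles using (CommutativeRing)
open import Data.Bool using (true; false)
open import Data.Nat as ℕ using (ℕ; zero; suc; _≤_; _∸_)
import Data.Nat.Properties as ℕ
open import Data.Integer as ℤ using (ℤ; +_; -[1+_]; _⊖_)
import Data.Integer.Properties as ℤ
open import Data.Integer.Tactic.RingSolver using (solve-∀)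
open import Data.List using (List; []; _∷_; _++_; map)
open import Data.List.Properties using (map-++; map-∘; map-cong)
open import Data.Vec using (_∷_)
open import Data.Fin.Subset using (Subset; ⊤; ∁; _∪_; _∩_; ∣_∣)
import Data.Fin.Subset.Properties as Subset
open import Data.Product using (_×_; _,_)
open import Data.Rational using (ℚ; 0ℚ; 1ℚ; _+_; _*_; _-_; ≢-nonZero)
import Data.Rational.Properties as ℚ
open import Data.Rational.Solver using (module +-*-Solver)
open import Function using (_∘_)
open import Relation.Binary.PropositionalEquality
open import Relation.Nullary using (yes; no; contradiction)

open +-*-Solver using (solve; _:+_; _:*_; _:-_; _:=_; con)
import Algebra.Properties.CommutativeSemiring.Exp
  (CommutativeRing.commutativeSemiring ℚ.+-*-commutativeRing) as Exp

pos-∸ : ∀ {m n} → n ≤ m → + (m ∸ n) ≡ + m ℤ.- + n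
pos-∸ {m} {n} n≤m = trans (sym (ℤ.⊖-≥ n≤m)) (sym (ℤ.m-n≡m⊖n m n))

pos-∣∁p∣ : ∀ {n} (A : Subset n) → + ∣ ∁ A ∣ ≡ + n ℤ.- + ∣ A ∣
pos-∣∁p∣ A = trans (cong +_ (Subset.∣∁p∣≡n∸∣p∣ A)) (pos-∸ (Subset.∣p∣≤n A))

∣∁p∣+∣p∣≡n : ∀ {n} (A : Subset n) → ∣ ∁ A ∣ ℕ.+ ∣ A ∣ ≡ n
∣∁p∣+∣p∣≡n A =
  trans (cong (ℕ._+ ∣ A ∣) (Subset.∣∁p∣≡n∸∣p∣ A)) (ℕ.m∸n+n≡m (Subset.∣p∣≤n A))

module _ {n} (M : Matroid n) where
  private
    r : Subset n → ℕ
    r = rank M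

  rank-∁⊤≡0 : r (∁ ⊤) ≡ 0
  rank-∁⊤≡0 = ℕ.n≤0⇒n≡0 (ℕ.≤-trans (rank-bound M (∁ ⊤)) (ℕ.≤-reflexive ∣∁⊤∣≡0))
    where
    ∣∁⊤∣≡0 : ∣ ∁ (⊤ {n}) ∣ ≡ 0
    ∣∁⊤∣≡0 = trans (Subset.∣∁p∣≡n∸∣p∣ (⊤ {n}))
                   (trans (cong (n ∸_) (Subset.∣⊤∣≡n n)) (ℕ.n∸n≡0 n))

  rank-⊤≤rank-∁+∣∣ : ∀ A → r ⊤ ≤ r (∁ A) ℕ.+ ∣ A ∣
  rank-⊤≤rank-∁+∣∣ A = begin
    r ⊤                         ≡⟨ cong r (Subset.p∪∁p≡⊤ A) ⟨
    r (A ∪ ∁ A)                 ≤⟨ ℕ.m≤m+n _ _ ⟩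
    r (A ∪ ∁ A) ℕ.+ r (A ∩ ∁ A) ≤⟨ rank-submod M A (∁ A) ⟩
    r A ℕ.+ r (∁ A)             ≤⟨ ℕ.+-monoˡ-≤ (r (∁ A)) (rank-bound M A) ⟩
    ∣ A ∣ ℕ.+ r (∁ A)           ≡⟨ ℕ.+-comm ∣ A ∣ (r (∁ A)) ⟩
    r (∁ A) ℕ.+ ∣ A ∣           ∎
    where open ℕ.≤-Reasoning

  pos-dualRank : ∀ A → + dualRank r A ≡ (+ r (∁ A) ℤ.+ + ∣ A ∣) ℤ.- + r ⊤
  pos-dualRank A =
    trans (pos-∸ (rank-⊤≤rank-∁+∣∣ A)) (cong (ℤ._- + r ⊤) (ℤ.pos-+ (r (∁ A)) ∣ A ∣))

  pos-dualRank-⊤ : + dualRank r ⊤ ≡ + n ℤ.- + r ⊤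
  pos-dualRank-⊤ = trans (pos-dualRank ⊤)
    (cong₂ (λ a b → (+ a ℤ.+ + b) ℤ.- + r ⊤) rank-∁⊤≡0 (Subset.∣⊤∣≡n n))

  dualRank-≤-⊤ : ∀ A → dualRank r A ≤ dualRank r ⊤
  dualRank-≤-⊤ A = ℕ.∸-monoˡ-≤ (r ⊤) (begin
    r (∁ A) ℕ.+ ∣ A ∣        ≤⟨ ℕ.+-monoˡ-≤ ∣ A ∣ (rank-bound M (∁ A)) ⟩
    ∣ ∁ A ∣ ℕ.+ ∣ A ∣        ≡⟨ ∣∁p∣+∣p∣≡n A ⟩
    n                        ≡⟨ Subset.∣⊤∣≡n n ⟨
    ∣ ⊤ {n} ∣                ≤⟨ ℕ.m≤n+m ∣ ⊤ {n} ∣ (r (∁ ⊤)) ⟩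
    r (∁ ⊤) ℕ.+ ∣ ⊤ {n} ∣    ∎)
    where open ℕ.≤-Reasoning

  dualRank-bound : ∀ A → dualRank r A ≤ ∣ A ∣
  dualRank-bound A = ℕ.≤-trans
    (ℕ.∸-monoˡ-≤ (r ⊤) (ℕ.+-monoˡ-≤ ∣ A ∣ (rank-mono M (∁ A) ⊤ Subset.⊆⊤)))
    (ℕ.≤-reflexive (ℕ.m+n∸m≡n (r ⊤) ∣ A ∣))

open ≡-Reasoning

≢1⇒-1≢0 : ∀ {u} → u ≢ 1ℚ → u - 1ℚ ≢ 0ℚ
≢1⇒-1≢0 {u} u≢1 u-1≡0 = u≢1 (begin
  u                 ≡⟨ solve 1 (λ u → u := (u :- con 1ℚ) :+ con 1ℚ) refl u ⟩
  (u - 1ℚ) + 1ℚ     ≡⟨ cong (_+ 1ℚ) u-1≡0 ⟩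
  0ℚ + 1ℚ           ≡⟨ ℚ.+-identityˡ 1ℚ ⟩
  1ℚ                ∎)

*-invʳ : ∀ {u} → u ≢ 0ℚ → u * inv u ≡ 1ℚ
*-invʳ {u} u≢0 with u ℚ.≟ 0ℚ
... | yes u≡0 = contradiction u≡0 u≢0
... | no  u≢0 = ℚ.*-inverseʳ u {{≢-nonZero u≢0}}

*-invˡ : ∀ {u} → u ≢ 0ℚ → inv u * u ≡ 1ℚ
*-invˡ {u} u≢0 = trans (ℚ.*-comm (inv u) u) (*-invʳ u≢0)

*≡1⇒≢0 : ∀ u v → u * v ≡ 1ℚ → u ≢ 0ℚ
*≡1⇒≢0 u v uv≡1 refl with trans (sym (ℚ.*-zeroˡ v)) uv≡1
... | ()

inv-unique : ∀ u v → u * v ≡ 1ℚ → inv u ≡ v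
inv-unique u v uv≡1 = begin
  inv u             ≡⟨ ℚ.*-identityʳ (inv u) ⟨
  inv u * 1ℚ        ≡⟨ cong (inv u *_) uv≡1 ⟨
  inv u * (u * v)   ≡⟨ solve 3 (λ i u v → i :* (u :* v) := (u :* i) :* v) refl (inv u) u v ⟩
  (u * inv u) * v   ≡⟨ cong (_* v) (*-invʳ (*≡1⇒≢0 u v uv≡1)) ⟩
  1ℚ * v            ≡⟨ ℚ.*-identityˡ v ⟩
  v                 ∎

inv-≢0 : ∀ {u} → u ≢ 0ℚ → inv u ≢ 0ℚ
inv-≢0 {u} u≢0 = *≡1⇒≢0 (inv u) u (*-invˡ u≢0)

*-invʳ-distrib : ∀ {u v} → u ≢ 0ℚ → v ≢ 0ℚ → (u * v) * (inv u * inv v) ≡ 1ℚ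
*-invʳ-distrib {u} {v} u≢0 v≢0 = begin
  (u * v) * (inv u * inv v)
    ≡⟨ solve 4 (λ u v i j → (u :* v) :* (i :* j) := (u :* i) :* (v :* j)) refl
         u v (inv u) (inv v) ⟩
  (u * inv u) * (v * inv v)   ≡⟨ cong₂ _*_ (*-invʳ u≢0) (*-invʳ v≢0) ⟩
  1ℚ * 1ℚ                     ≡⟨ ℚ.*-identityˡ 1ℚ ⟩
  1ℚ                          ∎

*-≢0 : ∀ {u v} → u ≢ 0ℚ → v ≢ 0ℚ → u * v ≢ 0ℚ
*-≢0 {u} {v} u≢0 v≢0 = *≡1⇒≢0 (u * v) (inv u * inv v) (*-invʳ-distrib u≢0 v≢0)

inv-distrib-* : ∀ {u v} → u ≢ 0ℚ → v ≢ 0ℚ → inv (u * v) ≡ inv u * inv v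
inv-distrib-* {u} {v} u≢0 v≢0 =
  inv-unique (u * v) (inv u * inv v) (*-invʳ-distrib u≢0 v≢0)

u*inv[u-1]-1≡inv[u-1] : ∀ u → u - 1ℚ ≢ 0ℚ → u * inv (u - 1ℚ) - 1ℚ ≡ inv (u - 1ℚ)
u*inv[u-1]-1≡inv[u-1] u u-1≢0 = begin
  u * i - 1ℚ
    ≡⟨ solve 2 (λ u i → u :* i :- con 1ℚ := ((u :- con 1ℚ) :* i :- con 1ℚ) :+ i) refl u i ⟩
  ((u - 1ℚ) * i - 1ℚ) + i      ≡⟨ cong (λ t → (t - 1ℚ) + i) (*-invʳ u-1≢0) ⟩
  (1ℚ - 1ℚ) + i                ≡⟨ solve 1 (λ i → (con 1ℚ :- con 1ℚ) :+ i := i) refl i ⟩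
  i                            ∎
  where
  i : ℚ
  i = inv (u - 1ℚ)

^≡Exp^ : ∀ u k → u ^ k ≡ u Exp.^ k
^≡Exp^ u zero    = refl
^≡Exp^ u (suc k) = cong (u *_) (^≡Exp^ u k)

^-+ : ∀ u m n → u ^ (m ℕ.+ n) ≡ u ^ m * u ^ n
^-+ u m n rewrite ^≡Exp^ u (m ℕ.+ n) | ^≡Exp^ u m | ^≡Exp^ u n = Exp.^-homo-* u m n

^-distrib-* : ∀ u v k → (u * v) ^ k ≡ u ^ k * v ^ k
^-distrib-* u v k rewrite ^≡Exp^ (u * v) k | ^≡Exp^ u k | ^≡Exp^ v k = Exp.^-distrib-* u v k

1^n≡1 : ∀ k → 1ℚ ^ k ≡ 1ℚ
1^n≡1 zero    = refl
1^n≡1 (suc k) = trans (ℚ.*-identityˡ (1ℚ ^ k)) (1^n≡1 k)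

^-inverse : ∀ u v k → u * v ≡ 1ℚ → u ^ k * v ^ k ≡ 1ℚ
^-inverse u v k uv≡1 = begin
  u ^ k * v ^ k   ≡⟨ ^-distrib-* u v k ⟨
  (u * v) ^ k     ≡⟨ cong (_^ k) uv≡1 ⟩
  1ℚ ^ k          ≡⟨ 1^n≡1 k ⟩
  1ℚ              ∎

^-≢0 : ∀ {u} k → u ≢ 0ℚ → u ^ k ≢ 0ℚ
^-≢0 {u} k u≢0 = *≡1⇒≢0 (u ^ k) (inv u ^ k) (^-inverse u (inv u) k (*-invʳ u≢0))

inv-^ : ∀ {u} k → u ≢ 0ℚ → inv (u ^ k) ≡ inv u ^ k
inv-^ {u} k u≢0 = inv-unique (u ^ k) (inv u ^ k) (^-inverse u (inv u) k (*-invʳ u≢0))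

^ℤ-⊖ : ∀ {u} → u ≢ 0ℚ → ∀ m n → u ^ℤ (m ⊖ n) ≡ u ^ m * inv u ^ n
^ℤ-⊖ {u} u≢0 zero    zero    = sym (ℚ.*-identityˡ 1ℚ)
^ℤ-⊖ {u} u≢0 zero    (suc n) = trans (inv-^ (suc n) u≢0) (sym (ℚ.*-identityˡ (inv u ^ suc n)))
^ℤ-⊖ {u} u≢0 (suc m) zero    = sym (ℚ.*-identityʳ (u ^ suc m))
^ℤ-⊖ {u} u≢0 (suc m) (suc n) = begin
  u ^ℤ (suc m ⊖ suc n)                ≡⟨ cong (u ^ℤ_) (ℤ.[1+m]⊖[1+n]≡m⊖n m n) ⟩
  u ^ℤ (m ⊖ n)                        ≡⟨ ^ℤ-⊖ u≢0 m n ⟩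
  u ^ m * inv u ^ n                   ≡⟨ ℚ.*-identityˡ (u ^ m * inv u ^ n) ⟨
  1ℚ * (u ^ m * inv u ^ n)            ≡⟨ cong (_* (u ^ m * inv u ^ n)) (*-invʳ u≢0) ⟨
  (u * inv u) * (u ^ m * inv u ^ n)
    ≡⟨ solve 4 (λ u i a b → (u :* i) :* (a :* b) := (u :* a) :* (i :* b)) refl
         u (inv u) (u ^ m) (inv u ^ n) ⟩
  u ^ suc m * inv u ^ suc n           ∎

^ℤ-+ : ∀ {u} → u ≢ 0ℚ → ∀ i j → u ^ℤ (i ℤ.+ j) ≡ u ^ℤ i * u ^ℤ j
^ℤ-+ {u} u≢0 (+ m)    (+ n)    = ^-+ u m n
^ℤ-+ {u} u≢0 (+ m)    -[1+ n ] =
  trans (^ℤ-⊖ u≢0 m (suc n)) (cong (u ^ m *_) (sym (inv-^ (suc n) u≢0)))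
^ℤ-+ {u} u≢0 -[1+ m ] (+ n)    =
  trans (^ℤ-⊖ u≢0 n (suc m))
    (trans (ℚ.*-comm (u ^ n) (inv u ^ suc m)) (cong (_* u ^ n) (sym (inv-^ (suc m) u≢0))))
^ℤ-+ {u} u≢0 -[1+ m ] -[1+ n ] = begin
  inv (u ^ suc (suc (m ℕ.+ n)))      ≡⟨ inv-^ (suc (suc (m ℕ.+ n))) u≢0 ⟩
  inv u ^ suc (suc (m ℕ.+ n))        ≡⟨ cong (λ k → inv u ^ suc k) (ℕ.+-suc m n) ⟨
  inv u ^ (suc m ℕ.+ suc n)          ≡⟨ ^-+ (inv u) (suc m) (suc n) ⟩
  inv u ^ suc m * inv u ^ suc n      ≡⟨ cong₂ _*_ (inv-^ (suc m) u≢0) (inv-^ (suc n) u≢0) ⟨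
  inv (u ^ suc m) * inv (u ^ suc n)  ∎

^ℤ-+-+ : ∀ {u} → u ≢ 0ℚ → ∀ i j k → u ^ℤ ((i ℤ.+ j) ℤ.+ k) ≡ (u ^ℤ i * u ^ℤ j) * u ^ℤ k
^ℤ-+-+ {u} u≢0 i j k = trans (^ℤ-+ u≢0 (i ℤ.+ j) k) (cong (_* u ^ℤ k) (^ℤ-+ u≢0 i j))

inv-^ℤ : ∀ {u} → u ≢ 0ℚ → ∀ i → inv u ^ℤ i ≡ u ^ℤ (ℤ.- i)
inv-^ℤ {u} u≢0 (+ zero)  = refl
inv-^ℤ {u} u≢0 (+ suc k) = sym (inv-^ (suc k) u≢0)
inv-^ℤ {u} u≢0 -[1+ k ]  =
  inv-unique (inv u ^ suc k) (u ^ suc k) (^-inverse (inv u) u (suc k) (*-invˡ u≢0))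

^ℤ-distrib-* : ∀ {u v} → u ≢ 0ℚ → v ≢ 0ℚ → ∀ i → (u * v) ^ℤ i ≡ u ^ℤ i * v ^ℤ i
^ℤ-distrib-* {u} {v} u≢0 v≢0 (+ k)    = ^-distrib-* u v k
^ℤ-distrib-* {u} {v} u≢0 v≢0 -[1+ k ] = begin
  inv ((u * v) ^ suc k)              ≡⟨ cong inv (^-distrib-* u v (suc k)) ⟩
  inv (u ^ suc k * v ^ suc k)        ≡⟨ inv-distrib-* (^-≢0 (suc k) u≢0) (^-≢0 (suc k) v≢0) ⟩
  inv (u ^ suc k) * inv (v ^ suc k)  ∎

^ℤ-distrib-*-inv : ∀ {u v w} → u ≢ 0ℚ → v ≢ 0ℚ → w ≢ 0ℚ → ∀ i →
  ((u * w) * inv v) ^ℤ i ≡ (u ^ℤ i * w ^ℤ i) * v ^ℤ (ℤ.- i)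
^ℤ-distrib-*-inv {u} {v} {w} u≢0 v≢0 w≢0 i = begin
  ((u * w) * inv v) ^ℤ i             ≡⟨ ^ℤ-distrib-* (*-≢0 u≢0 w≢0) (inv-≢0 v≢0) i ⟩
  (u * w) ^ℤ i * inv v ^ℤ i          ≡⟨ cong₂ _*_ (^ℤ-distrib-* u≢0 w≢0 i) (inv-^ℤ v≢0 i) ⟩
  (u ^ℤ i * w ^ℤ i) * v ^ℤ (ℤ.- i)   ∎

sumSubsets : ∀ {n} → (Subset n → ℚ) → ℚ
sumSubsets {n} f = sumℚ (map f (allSubsets n))

sumℚ-++ : ∀ xs ys → sumℚ (xs ++ ys) ≡ sumℚ xs + sumℚ ys
sumℚ-++ []       ys = sym (ℚ.+-identityˡ (sumℚ ys))
sumℚ-++ (x ∷ xs) ys =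
  trans (cong (_+_ x) (sumℚ-++ xs ys)) (sym (ℚ.+-assoc x (sumℚ xs) (sumℚ ys)))

sumℚ-*ˡ : ∀ c xs → sumℚ (map (c *_) xs) ≡ c * sumℚ xs
sumℚ-*ˡ c []       = sym (ℚ.*-zeroʳ c)
sumℚ-*ˡ c (x ∷ xs) =
  trans (cong (_+_ (c * x)) (sumℚ-*ˡ c xs)) (sym (ℚ.*-distribˡ-+ c x (sumℚ xs)))

sumSubsets-suc : ∀ {n} (f : Subset (suc n) → ℚ) →
  sumSubsets f ≡ sumSubsets (f ∘ (true ∷_)) + sumSubsets (f ∘ (false ∷_))
sumSubsets-suc {n} f = begin
  sumℚ (map f (map (true ∷_) L ++ map (false ∷_) L))
    ≡⟨ cong sumℚ (map-++ f (map (true ∷_) L) _) ⟩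
  sumℚ (map f (map (true ∷_) L) ++ map f (map (false ∷_) L))
    ≡⟨ sumℚ-++ (map f (map (true ∷_) L)) _ ⟩
  sumℚ (map f (map (true ∷_) L)) + sumℚ (map f (map (false ∷_) L))
    ≡⟨ cong₂ (λ xs ys → sumℚ xs + sumℚ ys) (map-∘ L) (map-∘ L) ⟨
  sumSubsets (f ∘ (true ∷_)) + sumSubsets (f ∘ (false ∷_))
    ∎
  where
  L : List (Subset n)
  L = allSubsets n

-- ∁ (b ∷ B) reduces to not b ∷ ∁ B, so complementation swaps the two halves.
sumSubsets-∁ : ∀ {n} (f : Subset n → ℚ) → sumSubsets (f ∘ ∁) ≡ sumSubsets f
sumSubsets-∁ {zero}  f = refl
sumSubsets-∁ {suc n} f = begin
  sumSubsets (f ∘ ∁)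
    ≡⟨ sumSubsets-suc (f ∘ ∁) ⟩
  sumSubsets (f ∘ (false ∷_) ∘ ∁) + sumSubsets (f ∘ (true ∷_) ∘ ∁)
    ≡⟨ cong₂ _+_ (sumSubsets-∁ (f ∘ (false ∷_))) (sumSubsets-∁ (f ∘ (true ∷_))) ⟩
  sumSubsets (f ∘ (false ∷_)) + sumSubsets (f ∘ (true ∷_))
    ≡⟨ ℚ.+-comm (sumSubsets (f ∘ (false ∷_))) _ ⟩
  sumSubsets (f ∘ (true ∷_)) + sumSubsets (f ∘ (false ∷_))
    ≡⟨ sumSubsets-suc f ⟨
  sumSubsets f
    ∎

sumSubsets-∁-* : ∀ {n} {f g : Subset n → ℚ} c → (∀ A → f A ≡ c * g (∁ A)) →
  sumSubsets f ≡ c * sumSubsets g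
sumSubsets-∁-* {n} {f} {g} c f≡cg∁ = begin
  sumℚ (map f L)                    ≡⟨ cong sumℚ (map-cong f≡cg∁ L) ⟩
  sumℚ (map ((c *_) ∘ g ∘ ∁) L)     ≡⟨ cong sumℚ (map-∘ L) ⟩
  sumℚ (map (c *_) (map (g ∘ ∁) L)) ≡⟨ sumℚ-*ˡ c (map (g ∘ ∁) L) ⟩
  c * sumSubsets (g ∘ ∁)            ≡⟨ cong (c *_) (sumSubsets-∁ g) ⟩
  c * sumSubsets g                  ∎
  where
  L : List (Subset n)
  L = allSubsets n

-- The summand of S: S r₁ r₂ X Y Z is definitionally sumSubsets (term r₁ r₂ X Y Z).
term : ∀ {n} → (Subset n → ℕ) → (Subset n → ℕ) → ℚ → ℚ → ℚ → Subset n → ℚ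
term r₁ r₂ X Y Z A = ((X - 1ℚ) ^ (r₁ ⊤ ∸ r₁ A))
                   * (((Y - 1ℚ) ^ (∣ A ∣ ∸ r₂ A))
                   * ((Z - 1ℚ) ^ ((r₂ A ℕ.+ r₁ ⊤) ∸ r₁ A)))

term-monomial : ∀ {n} (r₁ r₂ : Subset n → ℕ) X Y Z A → r₁ A ≤ r₁ ⊤ → r₂ A ≤ ∣ A ∣ →
  term r₁ r₂ X Y Z A
    ≡ (X - 1ℚ) ^ℤ (+ r₁ ⊤ ℤ.- + r₁ A)
      * ((Y - 1ℚ) ^ℤ (+ ∣ A ∣ ℤ.- + r₂ A)
      * (Z - 1ℚ) ^ℤ (+ r₂ A ℤ.+ (+ r₁ ⊤ ℤ.- + r₁ A)))
term-monomial r₁ r₂ X Y Z A r₁A≤r₁⊤ r₂A≤∣A∣ =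
  cong₂ _*_ (cong ((X - 1ℚ) ^ℤ_) (pos-∸ r₁A≤r₁⊤))
    (cong₂ _*_ (cong ((Y - 1ℚ) ^ℤ_) (pos-∸ r₂A≤∣A∣)) (cong ((Z - 1ℚ) ^ℤ_) z-exponent))
  where
  z-exponent : + ((r₂ A ℕ.+ r₁ ⊤) ∸ r₁ A) ≡ + r₂ A ℤ.+ (+ r₁ ⊤ ℤ.- + r₁ A)
  z-exponent = begin
    + ((r₂ A ℕ.+ r₁ ⊤) ∸ r₁ A)         ≡⟨ cong +_ (ℕ.+-∸-assoc (r₂ A) r₁A≤r₁⊤) ⟩
    + (r₂ A ℕ.+ (r₁ ⊤ ∸ r₁ A))         ≡⟨ ℤ.pos-+ (r₂ A) (r₁ ⊤ ∸ r₁ A) ⟩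
    + r₂ A ℤ.+ + (r₁ ⊤ ∸ r₁ A)         ≡⟨ cong (ℤ._+_ (+ r₂ A)) (pos-∸ r₁A≤r₁⊤) ⟩
    + r₂ A ℤ.+ (+ r₁ ⊤ ℤ.- + r₁ A)     ∎

dualTerm-monomial : ∀ {n} (M₁ M₂ : Matroid n) X Y Z A →
  term (dualRank (rank M₁)) (dualRank (rank M₂)) X Y Z A
    ≡ (X - 1ℚ) ^ℤ (+ ∣ ∁ A ∣ ℤ.- + rank M₁ (∁ A))
      * ((Y - 1ℚ) ^ℤ (+ rank M₂ ⊤ ℤ.- + rank M₂ (∁ A))
      * (Z - 1ℚ) ^ℤ (+ n ℤ.- (+ rank M₁ (∁ A) ℤ.+ (+ rank M₂ ⊤ ℤ.- + rank M₂ (∁ A)))))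
dualTerm-monomial {n} M₁ M₂ X Y Z A =
  trans (term-monomial (dualRank (rank M₁)) (dualRank (rank M₂)) X Y Z A
           (dualRank-≤-⊤ M₁ A) (dualRank-bound M₂ A))
    (cong₂ _*_ (cong ((X - 1ℚ) ^ℤ_) x-exponent)
      (cong₂ _*_ (cong ((Y - 1ℚ) ^ℤ_) y-exponent) (cong ((Z - 1ℚ) ^ℤ_) z-exponent)))
  where
  N K p₁ p₂ R₁ R₂ : ℤ
  N = + n
  K = + ∣ A ∣
  p₁ = + rank M₁ (∁ A)
  p₂ = + rank M₂ (∁ A)
  R₁ = + rank M₁ ⊤
  R₂ = + rank M₂ ⊤
  x-ring : ∀ N K p R → (N ℤ.- R) ℤ.- ((p ℤ.+ K) ℤ.- R) ≡ (N ℤ.- K) ℤ.- p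
  x-ring = solve-∀
  y-ring : ∀ K p R → K ℤ.- ((p ℤ.+ K) ℤ.- R) ≡ R ℤ.- p
  y-ring = solve-∀
  z-ring : ∀ N K p₁ R₁ p₂ R₂ →
    ((p₂ ℤ.+ K) ℤ.- R₂) ℤ.+ ((N ℤ.- R₁) ℤ.- ((p₁ ℤ.+ K) ℤ.- R₁)) ≡ N ℤ.- (p₁ ℤ.+ (R₂ ℤ.- p₂))
  z-ring = solve-∀
  x-exponent : + dualRank (rank M₁) ⊤ ℤ.- + dualRank (rank M₁) A ≡ + ∣ ∁ A ∣ ℤ.- p₁
  x-exponent = begin
    + dualRank (rank M₁) ⊤ ℤ.- + dualRank (rank M₁) A
      ≡⟨ cong₂ ℤ._-_ (pos-dualRank-⊤ M₁) (pos-dualRank M₁ A) ⟩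
    (N ℤ.- R₁) ℤ.- ((p₁ ℤ.+ K) ℤ.- R₁)   ≡⟨ x-ring N K p₁ R₁ ⟩
    (N ℤ.- K) ℤ.- p₁                     ≡⟨ cong (ℤ._- p₁) (pos-∣∁p∣ A) ⟨
    + ∣ ∁ A ∣ ℤ.- p₁                     ∎
  y-exponent : K ℤ.- + dualRank (rank M₂) A ≡ R₂ ℤ.- p₂
  y-exponent = trans (cong (ℤ._-_ K) (pos-dualRank M₂ A)) (y-ring K p₂ R₂)
  z-exponent : + dualRank (rank M₂) A ℤ.+ (+ dualRank (rank M₁) ⊤ ℤ.- + dualRank (rank M₁) A)
             ≡ N ℤ.- (p₁ ℤ.+ (R₂ ℤ.- p₂))
  z-exponent = begin
    + dualRank (rank M₂) A ℤ.+ (+ dualRank (rank M₁) ⊤ ℤ.- + dualRank (rank M₁) A)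
      ≡⟨ cong₂ ℤ._+_ (pos-dualRank M₂ A) (cong₂ ℤ._-_ (pos-dualRank-⊤ M₁) (pos-dualRank M₁ A)) ⟩
    ((p₂ ℤ.+ K) ℤ.- R₂) ℤ.+ ((N ℤ.- R₁) ℤ.- ((p₁ ℤ.+ K) ℤ.- R₁))
      ≡⟨ z-ring N K p₁ R₁ p₂ R₂ ⟩
    N ℤ.- (p₁ ℤ.+ (R₂ ℤ.- p₂))
      ∎

swappedDualTerm≡scaledTerm-∁ : ∀ {n} (M₁ M₂ : Matroid n) X Y Z → Z - 1ℚ ≢ 0ℚ → ∀ A →
  term (dualRank (rank M₂)) (dualRank (rank M₁)) X Y Z A
    ≡ (Z - 1ℚ) ^ n * term (rank M₁) (rank M₂) Y X (Z * inv (Z - 1ℚ)) (∁ A)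
swappedDualTerm≡scaledTerm-∁ {n} M₁ M₂ X Y Z z≢0 A = begin
  term (dualRank (rank M₂)) (dualRank (rank M₁)) X Y Z A
    ≡⟨ dualTerm-monomial M₂ M₁ X Y Z A ⟩
  x ^ℤ a * (y ^ℤ b * z ^ℤ (+ n ℤ.- e))
    ≡⟨ cong (λ t → x ^ℤ a * (y ^ℤ b * t)) (^ℤ-+ z≢0 (+ n) (ℤ.- e)) ⟩
  x ^ℤ a * (y ^ℤ b * (z ^ n * z ^ℤ (ℤ.- e)))
    ≡⟨ solve 4 (λ p q r s → p :* (q :* (r :* s)) := r :* (q :* (p :* s))) refl
         (x ^ℤ a) (y ^ℤ b) (z ^ n) (z ^ℤ (ℤ.- e)) ⟩
  z ^ n * (y ^ℤ b * (x ^ℤ a * z ^ℤ (ℤ.- e)))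
    ≡⟨ cong (λ t → z ^ n * (y ^ℤ b * (x ^ℤ a * t))) (inv-^ℤ z≢0 e) ⟨
  z ^ n * (y ^ℤ b * (x ^ℤ a * inv z ^ℤ e))
    ≡⟨ cong (λ t → z ^ n * (y ^ℤ b * (x ^ℤ a * t ^ℤ e))) (u*inv[u-1]-1≡inv[u-1] Z z≢0) ⟨
  z ^ n * (y ^ℤ b * (x ^ℤ a * (Z * inv z - 1ℚ) ^ℤ e))
    ≡⟨ cong (z ^ n *_) (term-monomial (rank M₁) (rank M₂) Y X (Z * inv z) (∁ A)
         (rank-mono M₁ (∁ A) ⊤ Subset.⊆⊤) (rank-bound M₂ (∁ A))) ⟨
  z ^ n * term (rank M₁) (rank M₂) Y X (Z * inv z) (∁ A)
    ∎
  where
  x y z : ℚ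
  x = X - 1ℚ
  y = Y - 1ℚ
  z = Z - 1ℚ
  a b e : ℤ
  a = + ∣ ∁ A ∣ ℤ.- + rank M₂ (∁ A)
  b = + rank M₁ ⊤ ℤ.- + rank M₁ (∁ A)
  e = + rank M₂ (∁ A) ℤ.+ b

dualTerm≡scaledTerm-∁ : ∀ {n} (M₁ M₂ : Matroid n) X Y Z →
  X - 1ℚ ≢ 0ℚ → Y - 1ℚ ≢ 0ℚ → Z - 1ℚ ≢ 0ℚ → ∀ A →
  term (dualRank (rank M₁)) (dualRank (rank M₂)) X Y Z A
    ≡ ((X - 1ℚ) ^ℤ (ℤ.- (+ rank M₁ ⊤))
      * ((Y - 1ℚ) ^ (rank M₂ ⊤) * (Z - 1ℚ) ^ℤ ((+ n) ℤ.- (+ rank M₁ ⊤) ℤ.- (+ rank M₂ ⊤))))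
      * term (rank M₁) (rank M₂) Y X (1ℚ + ((X - 1ℚ) * (Z - 1ℚ)) * inv (Y - 1ℚ)) (∁ A)
dualTerm≡scaledTerm-∁ {n} M₁ M₂ X Y Z x≢0 y≢0 z≢0 A = sym (begin
  prefactor * term (rank M₁) (rank M₂) Y X W (∁ A)
    ≡⟨ cong (prefactor *_) (term-monomial (rank M₁) (rank M₂) Y X W (∁ A)
         (rank-mono M₁ (∁ A) ⊤ Subset.⊆⊤) (rank-bound M₂ (∁ A))) ⟩
  prefactor * (y ^ℤ b * (x ^ℤ a * (W - 1ℚ) ^ℤ e))
    ≡⟨ cong (λ t → prefactor * (y ^ℤ b * (x ^ℤ a * t))) W-1-^ℤ ⟩
  (x ^ℤ (ℤ.- R₁) * (y ^ℤ R₂ * z ^ℤ c)) * (y ^ℤ b * (x ^ℤ a * ((x ^ℤ e * z ^ℤ e) * y ^ℤ (ℤ.- e))))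
    ≡⟨ solve 8 (λ x₁ y₁ z₁ y₂ x₂ x₃ z₃ y₃ →
                  (x₁ :* (y₁ :* z₁)) :* (y₂ :* (x₂ :* ((x₃ :* z₃) :* y₃)))
               := ((x₁ :* x₂) :* x₃) :* (((y₁ :* y₂) :* y₃) :* (z₁ :* z₃))) refl
         (x ^ℤ (ℤ.- R₁)) (y ^ℤ R₂) (z ^ℤ c) (y ^ℤ b) (x ^ℤ a) (x ^ℤ e) (z ^ℤ e) (y ^ℤ (ℤ.- e)) ⟩
  ((x ^ℤ (ℤ.- R₁) * x ^ℤ a) * x ^ℤ e) * (((y ^ℤ R₂ * y ^ℤ b) * y ^ℤ (ℤ.- e)) * (z ^ℤ c * z ^ℤ e))
    ≡⟨ cong₂ _*_ (^ℤ-+-+ x≢0 (ℤ.- R₁) a e)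
         (cong₂ _*_ (^ℤ-+-+ y≢0 R₂ b (ℤ.- e)) (^ℤ-+ z≢0 c e)) ⟨
  x ^ℤ ((ℤ.- R₁ ℤ.+ a) ℤ.+ e) * (y ^ℤ ((R₂ ℤ.+ b) ℤ.- e) * z ^ℤ (c ℤ.+ e))
    ≡⟨ cong₂ _*_ (cong (x ^ℤ_) (x-ring C p₁ p₂ R₁))
         (cong₂ _*_ (cong (y ^ℤ_) (y-ring p₁ p₂ R₁ R₂)) (cong (z ^ℤ_) (z-ring (+ n) p₁ p₂ R₁ R₂))) ⟩
  x ^ℤ (C ℤ.- p₁) * (y ^ℤ (R₂ ℤ.- p₂) * z ^ℤ (+ n ℤ.- (p₁ ℤ.+ (R₂ ℤ.- p₂))))
    ≡⟨ dualTerm-monomial M₁ M₂ X Y Z A ⟨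
  term (dualRank (rank M₁)) (dualRank (rank M₂)) X Y Z A
    ∎)
  where
  x y z W prefactor : ℚ
  x = X - 1ℚ
  y = Y - 1ℚ
  z = Z - 1ℚ
  W = 1ℚ + (x * z) * inv y
  C p₁ p₂ R₁ R₂ a b c e : ℤ
  C = + ∣ ∁ A ∣
  p₁ = + rank M₁ (∁ A)
  p₂ = + rank M₂ (∁ A)
  R₁ = + rank M₁ ⊤
  R₂ = + rank M₂ ⊤
  a = C ℤ.- p₂
  b = R₁ ℤ.- p₁
  c = (+ n) ℤ.- R₁ ℤ.- R₂
  e = p₂ ℤ.+ b
  prefactor = x ^ℤ (ℤ.- R₁) * (y ^ℤ R₂ * z ^ℤ c)
  W-1-^ℤ : (W - 1ℚ) ^ℤ e ≡ (x ^ℤ e * z ^ℤ e) * y ^ℤ (ℤ.- e)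
  W-1-^ℤ = trans (cong (_^ℤ e) (solve 1 (λ t → (con 1ℚ :+ t) :- con 1ℚ := t) refl ((x * z) * inv y)))
                 (^ℤ-distrib-*-inv x≢0 y≢0 z≢0 e)
  x-ring : ∀ C p₁ p₂ R₁ → (ℤ.- R₁ ℤ.+ (C ℤ.- p₂)) ℤ.+ (p₂ ℤ.+ (R₁ ℤ.- p₁)) ≡ C ℤ.- p₁
  x-ring = solve-∀
  y-ring : ∀ p₁ p₂ R₁ R₂ → (R₂ ℤ.+ (R₁ ℤ.- p₁)) ℤ.- (p₂ ℤ.+ (R₁ ℤ.- p₁)) ≡ R₂ ℤ.- p₂
  y-ring = solve-∀
  z-ring : ∀ N p₁ p₂ R₁ R₂ →
    ((N ℤ.- R₁) ℤ.- R₂) ℤ.+ (p₂ ℤ.+ (R₁ ℤ.- p₁)) ≡ N ℤ.- (p₁ ℤ.+ (R₂ ℤ.- p₂))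
  z-ring = solve-∀

proposition3p3 : (n : ℕ) (M₁ M₂ : Matroid n) (X Y Z : ℚ) →
    (Z ≢ 1ℚ →
      S (dualRank (rank M₂)) (dualRank (rank M₁)) X Y Z
        ≡ ((Z - 1ℚ) ^ n) * S (rank M₁) (rank M₂) Y X (Z * inv (Z - 1ℚ)))
    × (X ≢ 1ℚ → Y ≢ 1ℚ → Z ≢ 1ℚ →
      S (dualRank (rank M₁)) (dualRank (rank M₂)) X Y Z
        ≡ ((X - 1ℚ) ^ℤ (ℤ.- (+ rank M₁ ⊤)))
          * (((Y - 1ℚ) ^ (rank M₂ ⊤))
          * (((Z - 1ℚ) ^ℤ ((+ n) ℤ.- (+ rank M₁ ⊤) ℤ.- (+ rank M₂ ⊤)))
          * S (rank M₁) (rank M₂) Y X (1ℚ + ((X - 1ℚ) * (Z - 1ℚ)) * inv (Y - 1ℚ)))))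
proposition3p3 n M₁ M₂ X Y Z =
  (λ Z≢1 →
    sumSubsets-∁-* ((Z - 1ℚ) ^ n) (swappedDualTerm≡scaledTerm-∁ M₁ M₂ X Y Z (≢1⇒-1≢0 Z≢1))) ,
  (λ X≢1 Y≢1 Z≢1 → begin
    S (dualRank (rank M₁)) (dualRank (rank M₂)) X Y Z
      ≡⟨ sumSubsets-∁-* (a * (b * c))
           (dualTerm≡scaledTerm-∁ M₁ M₂ X Y Z (≢1⇒-1≢0 X≢1) (≢1⇒-1≢0 Y≢1) (≢1⇒-1≢0 Z≢1)) ⟩
    (a * (b * c)) * s   ≡⟨ ℚ.*-assoc a (b * c) s ⟩
    a * ((b * c) * s)   ≡⟨ cong (a *_) (ℚ.*-assoc b c s) ⟩
    a * (b * (c * s))   ∎)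
  where
  a b c s : ℚ
  a = (X - 1ℚ) ^ℤ (ℤ.- (+ rank M₁ ⊤))
  b = (Y - 1ℚ) ^ (rank M₂ ⊤)
  c = (Z - 1ℚ) ^ℤ ((+ n) ℤ.- (+ rank M₁ ⊤) ℤ.- (+ rank M₂ ⊤))
  s = S (rank M₁) (rank M₂) Y X (1ℚ + ((X - 1ℚ) * (Z - 1ℚ)) * inv (Y - 1ℚ))
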